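{- For any barred pattern $\mathsf{b}$, $\{\mathsf{v}^\circ : \mathsf{v}\in\mathrm{bond}(\mathsf{b})\}\cap \mathrm{Av}(\mathsf{b})=\emptyset$.
   Context: Permutations are in one-line notation, identified up to order isomorphism. A barred pattern is a permutation of $[n]$ in which a proper subset of letters carry bars; $\mathsf{b}^\circ$ ignores bars. A permutation $w$ contains $\mathsf{b}$ if $w$ has an occurrence of the unbarred portion of $\mathsf{b}$ that is not part of an occurrence of $\mathsf{b}^\circ$ (with those letters in the roles of the unbarred letters); otherwise $w$ avoids it; $\mathrm{Av}(\mathsf{b})$ is the set of permutations avoiding $\mathsf{b}$. A vincular pattern is a permutation with some consecutive symbols (including endpoints $\ast$) bonded; $\mathsf{v}^\circ$ denotes the underlying permutation with bonds ignored. $\mathrm{bond}(\mathsf{b})$ is the set of vincular patterns obtained by deleting a nonempty subset of the barred letters of $\mathsf{b}$, standardizing, and placing a bond between the two symbols (letters or endpoints) flanking each maximal run of deleted positions. -}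

module Defs where

open import Data.Nat using (ℕ)
open import Data.Bool using (Bool; true; false)
open import Data.Fin using (Fin; _<_)
open import Data.Product using (Σ; ∃; _×_; _,_)
open import Relation.Binary.PropositionalEquality using (_≡_)
open import Relation.Nullary using (¬_)
open import Function.Bundles using (_⇔_)
open import Function.Definitions using (Injective)

record Perm (n : ℕ) : Set where
  field
    fun : Fin n → Fin n
    inj : Injective _≡_ _≡_ fun
open Perm public

record BarredPattern (n : ℕ) : Set where
  field
    perm   : Perm n
    bar    : Fin n → Bool
    proper : ∃ λ i → bar i ≡ false
open BarredPattern public

record UnbarredOcc {n m : ℕ} (b : BarredPattern n) (w : Perm m) : Set where
  field
    pos  : (i : Fin n) → bar b i ≡ false → Fin m
    incr : ∀ i j (ui : bar b i ≡ false) (uj : bar b j ≡ false) →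
           i < j → pos i ui < pos j uj
    iso  : ∀ i j (ui : bar b i ≡ false) (uj : bar b j ≡ false) →
           (fun (perm b) i < fun (perm b) j) ⇔
           (fun w (pos i ui) < fun w (pos j uj))
open UnbarredOcc public

-- Occurrence of b° in w (all letters of b, bars ignored).
record FullOcc {n m : ℕ} (b : BarredPattern n) (w : Perm m) : Set where
  field
    fpos  : Fin n → Fin m
    fincr : ∀ i j → i < j → fpos i < fpos j
    fiso  : ∀ i j → (fun (perm b) i < fun (perm b) j) ⇔
                    (fun w (fpos i) < fun w (fpos j))
open FullOcc public

Extends : {n m : ℕ} {b : BarredPattern n} {w : Perm m} →
          UnbarredOcc b w → FullOcc b w → Set
Extends {b = b} o f = ∀ i (ui : bar b i ≡ false) → fpos f i ≡ pos o i ui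

Contains : {n m : ℕ} → BarredPattern n → Perm m → Set
Contains b w = ∃ λ (o : UnbarredOcc b w) → ¬ (∃ λ (f : FullOcc b w) → Extends o f)

Avoids : {n m : ℕ} → BarredPattern n → Perm m → Set
Avoids b w = ¬ Contains b w

-- A deletion set for bond(b): a nonempty subset of the barred letters
-- (del i ≡ true means position i is deleted).
record Deletion {n : ℕ} (b : BarredPattern n) : Set where
  field
    del      : Fin n → Bool
    onlyBar  : ∀ i → del i ≡ true → bar b i ≡ true
    nonempty : ∃ λ i → del i ≡ true
open Deletion public

-- w (a permutation of [m]) is v° for the vincular pattern v ∈ bond(b)
-- obtained from the deletion d: w is the standardization of the
-- subsequence of b° on the kept positions. Concretely: κ enumerates the
-- kept positions in increasing order (strictly increasing, onto the kept
-- positions) and w is order-isomorphic to b° ∘ κ (a permutation of [m]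
-- order-isomorphic to a word is its standardization).
record IsBondUnderlying {n m : ℕ} (b : BarredPattern n) (d : Deletion b)
                        (w : Perm m) : Set where
  field
    κ     : Fin m → Fin n
    κincr : ∀ i j → i < j → κ i < κ j
    κkept : ∀ i → del d (κ i) ≡ false
    κonto : ∀ j → del d j ≡ false → ∃ λ i → κ i ≡ j
    κiso  : ∀ i j → (fun w i < fun w j) ⇔
                    (fun (perm b) (κ i) < fun (perm b) (κ j))
open IsBondUnderlying public

InBondSet : {n m : ℕ} → BarredPattern n → Perm m → Set
InBondSet b w = ∃ λ (d : Deletion b) → IsBondUnderlying b d w

-- A member w of bond(b) is b° with a nonempty set of barred letters removed.
-- Every unbarred letter of b survives, so w contains an occurrence of the
-- unbarred portion of b; but w is strictly shorter than b°, so it contains no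
-- occurrence of b° at all, and that occurrence witnesses that w contains b.
module Submission where

open import Defs
open import Data.Nat using (ℕ; suc; s≤s)
import Data.Nat as ℕ
open import Data.Bool using (true; false)
open import Data.Fin using (Fin; _<_; punchOut)
open import Data.Fin.Properties
  using (<-cmp; <-irrefl; <-asym; injective⇒≤; <⇒notInjective; punchOut-injective)
open import Data.Product using (_×_; _,_; ∃)
open import Data.Empty using (⊥-elim)
open import Relation.Nullary using (¬_)
open import Relation.Binary using (tri<; tri≈; tri>)
open import Relation.Binary.PropositionalEquality using (_≡_; refl; sym; trans; cong; _≢_)
open import Function.Bundles using (_⇔_)
open import Function.Definitions using (Injective)
import Function.Properties.Equivalence as ⇔

StrictlyIncreasing : ∀ {m n} → (Fin m → Fin n) → Set
StrictlyIncreasing f = ∀ i j → i < j → f i < f j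

module _ {m n} {f : Fin m → Fin n} (f-incr : StrictlyIncreasing f) where

  strictlyIncreasing⇒injective : Injective _≡_ _≡_ f
  strictlyIncreasing⇒injective {i} {j} fi≡fj with <-cmp i j
  ... | tri< i<j _ _ = ⊥-elim (<-irrefl fi≡fj (f-incr i j i<j))
  ... | tri≈ _ i≡j _ = i≡j
  ... | tri> _ _ j<i = ⊥-elim (<-irrefl (sym fi≡fj) (f-incr j i j<i))

  strictlyIncreasing-reflects-< : ∀ i j → f i < f j → i < j
  strictlyIncreasing-reflects-< i j fi<fj with <-cmp i j
  ... | tri< i<j _ _ = i<j
  ... | tri≈ _ refl _ = ⊥-elim (<-irrefl refl fi<fj)
  ... | tri> _ _ j<i = ⊥-elim (<-asym fi<fj (f-incr j i j<i))

injective∧missing⇒< : ∀ {m n} {f : Fin m → Fin n} → Injective _≡_ _≡_ f →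
                      (j : Fin n) → (∀ i → j ≢ f i) → m ℕ.< n
injective∧missing⇒< {n = suc _} f-inj j j∉f =
  s≤s (injective⇒≤ (λ eq → f-inj (punchOut-injective (j∉f _) (j∉f _) eq)))

module _ {n} {b : BarredPattern n} where

  unbarred⇒kept : (d : Deletion b) → ∀ j → bar b j ≡ false → del d j ≡ false
  unbarred⇒kept d j unbarred with del d j in deleted
  ... | false = refl
  ... | true with () ← trans (sym (onlyBar d j deleted)) unbarred

  module _ {m} {d : Deletion b} {w : Perm m} (ib : IsBondUnderlying b d w) where

    bondUnderlying-shorter : m ℕ.< n
    bondUnderlying-shorter with nonempty d
    ... | j₀ , j₀-deleted =
      injective∧missing⇒< (strictlyIncreasing⇒injective (κincr ib)) j₀ j₀-not-kept
      where
      j₀-not-kept : ∀ i → j₀ ≢ κ ib i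
      j₀-not-kept i j₀≡κi with () ← trans (sym j₀-deleted) (trans (cong (del d) j₀≡κi) (κkept ib i))

    bondUnderlying⇒unbarredOcc : UnbarredOcc b w
    bondUnderlying⇒unbarredOcc = record { pos = pos′ ; incr = incr′ ; iso = iso′ }
      where
      preimage : ∀ j → bar b j ≡ false → ∃ λ i → κ ib i ≡ j
      preimage j unbarred = κonto ib j (unbarred⇒kept d j unbarred)

      pos′ : (j : Fin n) → bar b j ≡ false → Fin m
      pos′ j unbarred with preimage j unbarred
      ... | i , _ = i

      incr′ : ∀ i j (ui : bar b i ≡ false) (uj : bar b j ≡ false) → i < j → pos′ i ui < pos′ j uj
      incr′ i j ui uj i<j with preimage i ui | preimage j uj
      ... | a , refl | c , refl = strictlyIncreasing-reflects-< (κincr ib) a c i<j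

      iso′ : ∀ i j (ui : bar b i ≡ false) (uj : bar b j ≡ false) →
             (fun (perm b) i < fun (perm b) j) ⇔ (fun w (pos′ i ui) < fun w (pos′ j uj))
      iso′ i j ui uj with preimage i ui | preimage j uj
      ... | a , refl | c , refl = ⇔.sym (κiso ib a c)

  ¬fullOcc-in-shorter : ∀ {m} {w : Perm m} → m ℕ.< n → ¬ FullOcc b w
  ¬fullOcc-in-shorter m<n f = <⇒notInjective m<n (strictlyIncreasing⇒injective (fincr f))

corollary4p3 : (n : ℕ) (b : BarredPattern n) (m : ℕ) (w : Perm m) →
               ¬ (InBondSet b w × Avoids b w)
corollary4p3 n b m w ((d , ib) , avoids) =
  avoids ( bondUnderlying⇒unbarredOcc ib
         , λ (f , _) → ¬fullOcc-in-shorter (bondUnderlying-shorter ib) f )
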